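{- Let $M,M'\subseteq E^{n-1}$. Then $M$ is a mobile set and $M'$ is an alternative of $M$ if and only if the set $\{(x,|x|,0):x\in M\}\cup\{(x,|x|,1):x\in M'\}\subseteq E^{n+1}$ is an $i$-component with $i=n+1$.
   Context: $E^n$ denotes the set of binary words of length $n$ with the Hamming metric $d$; $e_i$ is the word with a single $1$ in coordinate $i$; $|x|$ is the sum of coordinates of $x$ modulo $2$. A set $M$ is a $1$-code if the balls of radius $1$ centered at distinct elements of $M$ are pairwise disjoint; $\Omega(M)=\{x: d(x,M)\le 1\}$. A set $M$ is a mobile set if it is a $1$-code and there is a $1$-code $M'$ with $M\cap M'=\emptyset$ and $\Omega(M)=\Omega(M')$; such $M'$ is an alternative of $M$. A mobile set $M$ is an $i$-component if $\Omega(M)=\Omega(M\oplus e_i)$, where $M\oplus e_i=\{x\oplus e_i:x\in M\}$. -}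

module Defs where

open import Data.Bool using (Bool; true; false; _xor_; if_then_else_)
open import Data.Nat using (ℕ; zero; suc; _+_; _≤_)
open import Data.Fin using (Fin; fromℕ)
open import Data.Fin.Properties using (_≟_)
open import Data.Vec using (Vec; []; _∷_; zipWith; foldr; tabulate; _++_)
open import Data.Product using (Σ; _×_; ∃; _,_)
open import Data.Sum using (_⊎_)
open import Data.Empty using (⊥)
open import Relation.Nullary using (¬_; does)
open import Relation.Binary.PropositionalEquality using (_≡_; _≢_)
open import Function.Bundles using (_⇔_)
open import Level using (0ℓ)
open import Relation.Unary using (Pred)

E : ℕ → Set
E n = Vec Bool n

Subset : ℕ → Set₁
Subset n = Pred (E n) 0ℓ

_⊕_ : ∀ {n} → E n → E n → E n
_⊕_ = zipWith _xor_

wt : ∀ {n} → E n → ℕ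
wt = foldr (λ _ → ℕ) (λ b k → (if b then 1 else 0) + k) 0

d : ∀ {n} → E n → E n → ℕ
d x y = wt (x ⊕ y)

-- |x| : sum of coordinates modulo 2
par : ∀ {n} → E n → Bool
par = foldr (λ _ → Bool) _xor_ false

-- e_i : single 1 in coordinate i (Fin index, 0-based)
e : ∀ {n} → Fin n → E n
e i = tabulate (λ j → does (j ≟ i))

_≐_ : ∀ {n} → Subset n → Subset n → Set
A ≐ B = ∀ x → A x ⇔ B x

Ω : ∀ {n} → Subset n → Subset n
Ω M x = ∃ λ y → M y × d x y ≤ 1

OneCode : ∀ {n} → Subset n → Set
OneCode M = ∀ x y → M x → M y → x ≢ y →
  ¬ (∃ λ z → d z x ≤ 1 × d z y ≤ 1)

Disjoint : ∀ {n} → Subset n → Subset n → Set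
Disjoint A B = ∀ x → A x → B x → ⊥

IsAlternative : ∀ {n} → Subset n → Subset n → Set
IsAlternative M M' = OneCode M' × Disjoint M M' × (Ω M ≐ Ω M')

Mobile : ∀ {n} → Subset n → Set₁
Mobile M = OneCode M × Σ (Subset _) (λ M' → IsAlternative M M')

shift : ∀ {n} → Subset n → Fin n → Subset n
shift M i y = ∃ λ x → M x × y ≡ x ⊕ e i

IsComponent : ∀ {n} → Fin n → Subset n → Set₁
IsComponent i M = Mobile M × (Ω M ≐ Ω (shift M i))

lift : ∀ {m} → Subset m → Subset m → Subset (m + 2)
lift M M' z = ∃ λ x → (M x × z ≡ x ++ (par x ∷ false ∷ []))
                    ⊎ (M' x × z ≡ x ++ (par x ∷ true ∷ []))

-- last coordinate (coordinate m+2 in 1-based numbering) of E^{m+2}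
lastCoord : ∀ m → Fin (m + 2)
lastCoord zero = fromℕ 1
lastCoord (suc m) = Data.Fin.suc (lastCoord m)

-- The words (x , |x|) form the even-weight code, in which distinct words are at distance at
-- least 2. Hence a word (w , |w| , c) is within distance 1 of a lifted codeword (a , |a| , r)
-- only if a = w, whereas (w , ¬|w| , c) is within distance 1 of it exactly when c = r and
-- d(w , a) ≤ 1. So the lifted set is a 1-code iff M and M' are disjoint 1-codes, and its
-- neighbourhood is read off layer by layer from M ∪ M', Ω(M) and Ω(M'). Adding e_{n+1}
-- swaps the two layers, so the neighbourhood is preserved iff Ω(M) = Ω(M').
module Submission where

open import Defs
open import Data.Nat using (ℕ; zero; suc; pred; _+_; _≤_; z≤n; s≤s)
open import Data.Nat.Properties using (+-assoc; m+n≤o⇒m≤o; m+n≤o⇒n≤o; n≤0⇒n≡0)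
open import Data.Bool using (Bool; true; false; _xor_; not; if_then_else_)
open import Data.Bool.Properties
  using (_≟_; xor-same; xor-identityʳ; xor-inverseˡ; not-involutive; not-distribˡ-xor; ¬-not; not-¬)
open import Data.Vec using ([]; _∷_; _++_; splitAt)
open import Data.Vec.Properties using (++-injectiveˡ; ++-injectiveʳ; ∷-injectiveˡ; ∷-injectiveʳ)
open import Data.Product using (∃; _×_; _,_)
open import Data.Empty using (⊥-elim)
open import Data.Sum using (inj₁; inj₂)
open import Function.Base using (_∘_; flip)
open import Function.Bundles using (_⇔_; mk⇔; Equivalence)
open import Function.Properties.Equivalence using () renaming (sym to ⇔-sym; trans to ⇔-trans)
open import Relation.Nullary using (yes; no)
open import Relation.Unary using (_⊆_)
open import Relation.Binary.PropositionalEquality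
  using (_≡_; refl; sym; trans; cong; cong₂; subst; module ≡-Reasoning)
open Equivalence

≐-sym : ∀ {n} {X Y : Subset n} → X ≐ Y → Y ≐ X
≐-sym X≐Y x = ⇔-sym (X≐Y x)

≐-trans : ∀ {n} {X Y Z : Subset n} → X ≐ Y → Y ≐ Z → X ≐ Z
≐-trans X≐Y Y≐Z x = ⇔-trans (X≐Y x) (Y≐Z x)

≐⇒⊆ : ∀ {n} {X Y : Subset n} → X ≐ Y → X ⊆ Y
≐⇒⊆ X≐Y {x} = to (X≐Y x)

Ω-mono : ∀ {n} {X Y : Subset n} → X ⊆ Y → Ω X ⊆ Ω Y
Ω-mono X⊆Y (y , Xy , d≤1) = y , X⊆Y {y} Xy , d≤1

Ω-cong : ∀ {n} {X Y : Subset n} → X ≐ Y → Ω X ≐ Ω Y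
Ω-cong X≐Y x = mk⇔ (Ω-mono (≐⇒⊆ X≐Y) {x}) (Ω-mono (≐⇒⊆ (≐-sym X≐Y)) {x})

OneCode-anti : ∀ {n} {X Y : Subset n} → X ⊆ Y → OneCode Y → OneCode X
OneCode-anti X⊆Y ocY x y Xx Xy = ocY x y (X⊆Y {x} Xx) (X⊆Y {y} Xy)

bit : Bool → ℕ
bit b = if b then 1 else 0

wt-++ : ∀ {k l} (u : E k) (v : E l) → wt (u ++ v) ≡ wt u + wt v
wt-++ []      v = refl
wt-++ (a ∷ u) v = trans (cong (bit a +_) (wt-++ u v)) (sym (+-assoc (bit a) (wt u) (wt v)))

⊕-++ : ∀ {k l} (u u' : E k) (v v' : E l) → (u ++ v) ⊕ (u' ++ v') ≡ (u ⊕ u') ++ (v ⊕ v')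
⊕-++ []      []       v v' = refl
⊕-++ (a ∷ u) (b ∷ u') v v' = cong ((a xor b) ∷_) (⊕-++ u u' v v')

d-++ : ∀ {k l} (u u' : E k) (v v' : E l) → d (u ++ v) (u' ++ v') ≡ d u u' + d v v'
d-++ u u' v v' = trans (cong wt (⊕-++ u u' v v')) (wt-++ (u ⊕ u') (v ⊕ v'))

d-refl : ∀ {n} (x : E n) → d x x ≡ 0
d-refl []      = refl
d-refl (a ∷ x) = cong₂ _+_ (cong bit (xor-same a)) (d-refl x)

d≡0⇒≡ : ∀ {n} (x y : E n) → d x y ≡ 0 → x ≡ y
d≡0⇒≡ []          []          _  = refl
d≡0⇒≡ (true ∷ x)  (true ∷ y)  eq = cong (true ∷_) (d≡0⇒≡ x y eq)
d≡0⇒≡ (false ∷ x) (false ∷ y) eq = cong (false ∷_) (d≡0⇒≡ x y eq)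

d≡1⇒par≡not : ∀ {n} (x y : E n) → d x y ≡ 1 → par x ≡ not (par y)
d≡1⇒par≡not []          []          ()
d≡1⇒par≡not (true ∷ x)  (true ∷ y)  eq = cong not (d≡1⇒par≡not x y eq)
d≡1⇒par≡not (false ∷ x) (false ∷ y) eq = d≡1⇒par≡not x y eq
d≡1⇒par≡not (true ∷ x)  (false ∷ y) eq = cong (not ∘ par) (d≡0⇒≡ x y (cong pred eq))
d≡1⇒par≡not (false ∷ x) (true ∷ y)  eq =
  trans (cong par (d≡0⇒≡ x y (cong pred eq))) (sym (not-involutive (par y)))

d≤1⇒d≡bit-par : ∀ {n} (x y : E n) → d x y ≤ 1 → d x y ≡ bit (par x xor par y)
d≤1⇒d≡bit-par x y d≤1 with d x y in eq
... | 0 = sym (cong bit (trans (cong (λ v → par v xor par y) (d≡0⇒≡ x y eq)) (xor-same (par y))))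
... | 1 = sym (cong bit (trans (cong (_xor par y) (d≡1⇒par≡not x y eq)) (xor-inverseˡ (par y))))
d≤1⇒d≡bit-par x y (s≤s ()) | suc (suc _)

⟨_,_,_⟩ : ∀ {m} → E m → Bool → Bool → E (m + 2)
⟨ w , p , c ⟩ = w ++ (p ∷ c ∷ [])

⟨⟩-injectiveˡ : ∀ {m} {a b : E m} {p q c r} → ⟨ a , p , c ⟩ ≡ ⟨ b , q , r ⟩ → a ≡ b
⟨⟩-injectiveˡ {a = a} {b} = ++-injectiveˡ a b

⟨⟩-injectiveʳ : ∀ {m} {a b : E m} {p q c r} → ⟨ a , p , c ⟩ ≡ ⟨ b , q , r ⟩ → c ≡ r
⟨⟩-injectiveʳ {a = a} {b} = ∷-injectiveˡ ∘ ∷-injectiveʳ ∘ ++-injectiveʳ a b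

d-⟨⟩ : ∀ {m} (w a : E m) p c q r →
  d ⟨ w , p , c ⟩ ⟨ a , q , r ⟩ ≡ d w a + (bit (p xor q) + d (c ∷ []) (r ∷ []))
d-⟨⟩ w a p c q r = d-++ w a (p ∷ c ∷ []) (q ∷ r ∷ [])

d-⟨⟩-last≤1 : ∀ {m} (w : E m) p c r → d ⟨ w , p , c ⟩ ⟨ w , p , r ⟩ ≤ 1
d-⟨⟩-last≤1 w p c r rewrite d-⟨⟩ w w p c p r | d-refl w | xor-same p = last≤1 c r
  where
    last≤1 : ∀ c r → d (c ∷ []) (r ∷ []) ≤ 1
    last≤1 true  true  = z≤n
    last≤1 true  false = s≤s z≤n
    last≤1 false true  = s≤s z≤n
    last≤1 false false = z≤n

⊕-e-last : ∀ m (w : E m) p c → ⟨ w , p , c ⟩ ⊕ e (lastCoord m) ≡ ⟨ w , p , not c ⟩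
⊕-e-last zero    []      p true  = cong (λ q → q ∷ false ∷ []) (xor-identityʳ p)
⊕-e-last zero    []      p false = cong (λ q → q ∷ true ∷ []) (xor-identityʳ p)
⊕-e-last (suc m) (a ∷ w) p c     = cong₂ _∷_ (xor-identityʳ a) (⊕-e-last m w p c)

data ParityView {m} : E (m + 2) → Set where
  even : ∀ w c → ParityView ⟨ w , par w , c ⟩
  odd  : ∀ w c → ParityView ⟨ w , not (par w) , c ⟩

parityView : ∀ m (z : E (m + 2)) → ParityView z
parityView m z with splitAt m z
... | w , p ∷ c ∷ [] , refl with p ≟ par w
...   | yes refl   = even w c
...   | no  p≢par = subst (λ q → ParityView ⟨ w , q , c ⟩) (sym (¬-not p≢par)) (odd w c)

double≤1⇒≡0 : ∀ k j → k + (k + j) ≤ 1 → k ≡ 0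
double≤1⇒≡0 zero    j _       = refl
double≤1⇒≡0 (suc k) j (s≤s h) with m+n≤o⇒n≤o k h
... | ()

bit+bit-not : ∀ x n → bit x + (bit (not x) + n) ≡ suc n
bit+bit-not true  n = refl
bit+bit-not false n = refl

near-even⇒≡ : ∀ {m} (w a : E m) c r → d ⟨ w , par w , c ⟩ ⟨ a , par a , r ⟩ ≤ 1 → w ≡ a
near-even⇒≡ w a c r near = d≡0⇒≡ w a (trans d≡bit (double≤1⇒≡0 (bit x) d₁ near'))
  where
    x = par w xor par a
    d₁ = d (c ∷ []) (r ∷ [])
    near₀ : d w a + (bit x + d₁) ≤ 1
    near₀ = subst (_≤ 1) (d-⟨⟩ w a (par w) c (par a) r) near
    d≡bit : d w a ≡ bit x
    d≡bit = d≤1⇒d≡bit-par w a (m+n≤o⇒m≤o (d w a) near₀)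
    near' : bit x + (bit x + d₁) ≤ 1
    near' = subst (λ k → k + (bit x + d₁) ≤ 1) d≡bit near₀

d-odd : ∀ {m} (w a : E m) c r → d w a ≤ 1 →
  d ⟨ w , not (par w) , c ⟩ ⟨ a , par a , r ⟩ ≡ suc (d (c ∷ []) (r ∷ []))
d-odd w a c r d≤1 = begin
  d ⟨ w , not (par w) , c ⟩ ⟨ a , par a , r ⟩
    ≡⟨ d-⟨⟩ w a (not (par w)) c (par a) r ⟩
  d w a + (bit (not (par w) xor par a) + d₁)
    ≡⟨ cong₂ (λ k b → k + (bit b + d₁)) (d≤1⇒d≡bit-par w a d≤1) (sym (not-distribˡ-xor (par w) (par a))) ⟩
  bit x + (bit (not x) + d₁)
    ≡⟨ bit+bit-not x d₁ ⟩
  suc d₁ ∎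
  where
    open ≡-Reasoning
    x = par w xor par a
    d₁ = d (c ∷ []) (r ∷ [])

near-odd⇒ : ∀ {m} (w a : E m) c r → d ⟨ w , not (par w) , c ⟩ ⟨ a , par a , r ⟩ ≤ 1 →
  d w a ≤ 1 × c ≡ r
near-odd⇒ w a c r near = d≤1 , ∷-injectiveˡ (d≡0⇒≡ (c ∷ []) (r ∷ []) (n≤0⇒n≡0 d₁≤0))
  where
    d≤1 : d w a ≤ 1
    d≤1 = m+n≤o⇒m≤o (d w a) (subst (_≤ 1) (d-⟨⟩ w a (not (par w)) c (par a) r) near)
    d₁≤0 : d (c ∷ []) (r ∷ []) ≤ 0
    d₁≤0 with s≤s h ← subst (_≤ 1) (d-odd w a c r d≤1) near = h

near-odd⇐ : ∀ {m} (w a : E m) c → d w a ≤ 1 → d ⟨ w , not (par w) , c ⟩ ⟨ a , par a , c ⟩ ≤ 1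
near-odd⇐ w a c d≤1 rewrite d-odd w a c c d≤1 | d-refl (c ∷ []) = s≤s z≤n

layer : ∀ {m} → Subset m → Subset m → Bool → Subset m
layer A A' false = A
layer A A' true  = A'

data InLift {m} (A A' : Subset m) : E (m + 2) → Set where
  codeword : ∀ {a} r → layer A A' r a → InLift A A' ⟨ a , par a , r ⟩

module _ {m : ℕ} (A A' : Subset m) where

  inLift : ∀ {z} → lift A A' z → InLift A A' z
  inLift (a , inj₁ (Aa , refl)) = codeword false Aa
  inLift (a , inj₂ (Aa , refl)) = codeword true Aa

  ∈-lift : ∀ {a} r → layer A A' r a → lift A A' ⟨ a , par a , r ⟩
  ∈-lift false Aa = _ , inj₁ (Aa , refl)
  ∈-lift true  Aa = _ , inj₂ (Aa , refl)

  lift-∈ : ∀ {a p r} → lift A A' ⟨ a , p , r ⟩ → layer A A' r a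
  lift-∈ (b , inj₁ (Ab , eq)) with refl ← ⟨⟩-injectiveˡ eq | refl ← ⟨⟩-injectiveʳ eq = Ab
  lift-∈ (b , inj₂ (Ab , eq)) with refl ← ⟨⟩-injectiveˡ eq | refl ← ⟨⟩-injectiveʳ eq = Ab

  layer-not : ∀ {a} r → layer A A' r a → layer A' A (not r) a
  layer-not false Aa = Aa
  layer-not true  Aa = Aa

  layer-unique : Disjoint A A' → ∀ {a} r s → layer A A' r a → layer A A' s a → r ≡ s
  layer-unique dj false false _  _  = refl
  layer-unique dj true  true  _  _  = refl
  layer-unique dj false true  Aa Ba = ⊥-elim (dj _ Aa Ba)
  layer-unique dj true  false Ba Aa = ⊥-elim (dj _ Aa Ba)

  layer-OneCode : OneCode A → OneCode A' → ∀ r → OneCode (layer A A' r)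
  layer-OneCode oc oc' false = oc
  layer-OneCode oc oc' true  = oc'

  Ω-lift-even : ∀ {w c} → Ω (lift A A') ⟨ w , par w , c ⟩ → ∃ λ r → layer A A' r w
  Ω-lift-even {w} {c} (_ , y∈ , near) with inLift y∈
  ... | codeword {a} r la with refl ← near-even⇒≡ w a c r near = r , la

  Ω-lift-even⁻¹ : ∀ {w} c r → layer A A' r w → Ω (lift A A') ⟨ w , par w , c ⟩
  Ω-lift-even⁻¹ {w} c r lw = _ , ∈-lift r lw , d-⟨⟩-last≤1 w (par w) c r

  Ω-lift-odd : ∀ {w c} → Ω (lift A A') ⟨ w , not (par w) , c ⟩ → Ω (layer A A' c) w
  Ω-lift-odd {w} {c} (_ , y∈ , near) with inLift y∈
  ... | codeword {a} r la with d≤1 , refl ← near-odd⇒ w a c r near = a , la , d≤1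

  Ω-lift-odd⁻¹ : ∀ {w} c → Ω (layer A A' c) w → Ω (lift A A') ⟨ w , not (par w) , c ⟩
  Ω-lift-odd⁻¹ {w} c (a , la , d≤1) = _ , ∈-lift c la , near-odd⇐ w a c d≤1

  lift-OneCode : OneCode A → OneCode A' → Disjoint A A' → OneCode (lift A A')
  lift-OneCode oc oc' dj u v u∈ v∈ u≢v (z , near-u , near-v)
    with inLift u∈ | inLift v∈ | parityView m z
  ... | codeword {a} r la | codeword {b} s lb | even w c
    with refl ← near-even⇒≡ w a c r near-u | refl ← near-even⇒≡ w b c s near-v
    = u≢v (cong (λ t → ⟨ w , par w , t ⟩) (layer-unique dj r s la lb))
  ... | codeword {a} r la | codeword {b} s lb | odd w c
    with d≤1 , refl ← near-odd⇒ w a c r near-u | d≤1' , refl ← near-odd⇒ w b c s near-v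
    = layer-OneCode oc oc' c a b la lb (u≢v ∘ cong (λ x → ⟨ x , par x , c ⟩)) (w , d≤1 , d≤1')

  OneCode-layer : OneCode (lift A A') → ∀ r → OneCode (layer A A' r)
  OneCode-layer oc r a b la lb a≢b (w , d≤1 , d≤1') =
    oc _ _ (∈-lift r la) (∈-lift r lb) (a≢b ∘ ⟨⟩-injectiveˡ)
      (⟨ w , not (par w) , r ⟩ , near-odd⇐ w a r d≤1 , near-odd⇐ w b r d≤1')

  OneCode⇒Disjoint : OneCode (lift A A') → Disjoint A A'
  OneCode⇒Disjoint oc a Aa A'a =
    oc _ _ (∈-lift false Aa) (∈-lift true A'a) ((λ ()) ∘ ⟨⟩-injectiveʳ)
      (⟨ a , par a , false ⟩ , d-⟨⟩-last≤1 a (par a) false false , d-⟨⟩-last≤1 a (par a) false true)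

  OneCode-lift : OneCode (lift A A') ⇔ (OneCode A × OneCode A' × Disjoint A A')
  OneCode-lift = mk⇔
    (λ oc → OneCode-layer oc false , OneCode-layer oc true , OneCode⇒Disjoint oc)
    (λ (oc , oc' , dj) → lift-OneCode oc oc' dj)

module _ {m : ℕ} (A A' : Subset m) where

  shift-lift⊆ : shift (lift A A') (lastCoord m) ⊆ lift A' A
  shift-lift⊆ (_ , y∈ , refl) with inLift A A' y∈
  ... | codeword {a} r la =
    subst (lift A' A) (sym (⊕-e-last m a (par a) r)) (∈-lift A' A (not r) (layer-not A A' r la))

  lift⊆shift-lift : lift A' A ⊆ shift (lift A A') (lastCoord m)
  lift⊆shift-lift z∈ with inLift A' A z∈
  ... | codeword {a} r la =
    ⟨ a , par a , not r ⟩ , ∈-lift A A' (not r) (layer-not A' A r la) ,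
    sym (trans (⊕-e-last m a (par a) (not r)) (cong (λ t → ⟨ a , par a , t ⟩) (not-involutive r)))

  shift-lift : shift (lift A A') (lastCoord m) ≐ lift A' A
  shift-lift z = mk⇔ shift-lift⊆ lift⊆shift-lift

  lift-Disjoint : Disjoint A A' → Disjoint (lift A A') (lift A' A)
  lift-Disjoint dj _ z∈ z∈' with inLift A A' z∈
  ... | codeword r la = not-¬ refl (layer-unique A A' dj r (not r) la (layer-not A' A r (lift-∈ A' A z∈')))

  Ω-layer-swap : Ω A ≐ Ω A' → ∀ c → Ω (layer A A' c) ⊆ Ω (layer A' A c)
  Ω-layer-swap Ω≐ false {w} = to (Ω≐ w)
  Ω-layer-swap Ω≐ true  {w} = from (Ω≐ w)

  Ω-lift-swap : Ω A ≐ Ω A' → Ω (lift A A') ⊆ Ω (lift A' A)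
  Ω-lift-swap Ω≐ {z} z∈Ω with parityView m z
  ... | even w c with r , lw ← Ω-lift-even A A' {w} {c} z∈Ω =
    Ω-lift-even⁻¹ A' A {w} c (not r) (layer-not A A' r lw)
  ... | odd w c = Ω-lift-odd⁻¹ A' A {w} c (Ω-layer-swap Ω≐ c {w} (Ω-lift-odd A A' {w} {c} z∈Ω))

  Ω-lift-swap⁻¹ : Ω (lift A A') ⊆ Ω (lift A' A) → Ω A ⊆ Ω A'
  Ω-lift-swap⁻¹ Ω⊆ {w} =
    Ω-lift-odd A' A {w} {false} ∘ Ω⊆ {⟨ w , not (par w) , false ⟩} ∘ Ω-lift-odd⁻¹ A A' {w} false

Ω-lift-≐ : ∀ {m} (A A' : Subset m) → (Ω (lift A A') ≐ Ω (lift A' A)) ⇔ (Ω A ≐ Ω A')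
Ω-lift-≐ A A' = mk⇔
  (λ Ω≐ w → mk⇔ (Ω-lift-swap⁻¹ A A' (λ {z} → to (Ω≐ z)) {w})
                 (Ω-lift-swap⁻¹ A' A (λ {z} → from (Ω≐ z)) {w}))
  (λ Ω≐ z → mk⇔ (Ω-lift-swap A A' Ω≐ {z}) (Ω-lift-swap A' A (λ w → ⇔-sym (Ω≐ w)) {z}))

corollary2 : (m : ℕ) (M M' : Subset m) →
    (Mobile M × IsAlternative M M') ⇔ IsComponent (lastCoord m) (lift M M')
corollary2 m M M' = mk⇔ fwd bwd
  where
    N = lift M M'
    i = lastCoord m

    fwd : Mobile M × IsAlternative M M' → IsComponent i N
    fwd ((ocM , _) , ocM' , dj , Ω≐) = (ocN , shift N i , ocS , djS , ΩN≐) , ΩN≐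
      where
        ocN = from (OneCode-lift M M') (ocM , ocM' , dj)
        ocS = OneCode-anti (shift-lift⊆ M M') (from (OneCode-lift M' M) (ocM' , ocM , λ x → flip (dj x)))
        djS : Disjoint N (shift N i)
        djS z z∈N z∈S = lift-Disjoint M M' dj z z∈N (shift-lift⊆ M M' z∈S)
        ΩN≐ = ≐-trans (from (Ω-lift-≐ M M') Ω≐) (≐-sym (Ω-cong (shift-lift M M')))

    bwd : IsComponent i N → Mobile M × IsAlternative M M'
    bwd ((ocN , _) , ΩN≐) =
      let ocM , ocM' , dj = to (OneCode-lift M M') ocN
          alt : IsAlternative M M'
          alt = ocM' , dj , to (Ω-lift-≐ M M') (≐-trans ΩN≐ (Ω-cong (shift-lift M M')))
      in (ocM , M' , alt) , alt
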